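{- Let $B$ be a finite Boolean algebra, $\mathscr K$ an ultracontact on $B$, and $F\subseteq B$ non-empty. Then $F\in\mathscr K$ if and only if there exists $G\subseteq\mathrm{Atom}(B)$ such that $G\preceq F$ and $G\in\mathscr K$.
   Context: Let $B$ be a non-trivial Boolean algebra with order $\le$ and join $+$; $\mathrm{Atom}(B)$ is its set of atoms. For $F,G\subseteq B$ put $F+G=\{f+g: f\in F,\ g\in G\}$, and write $F\preceq G$ iff for every $g\in G$ there is $f\in F$ with $f\le g$. An ultracontact on $B$ is a family $\mathscr K\subseteq 2^B$ such that for all $F,G\subseteq B$: (K0) $\emptyset\notin\mathscr K$; (K1) if $0\in F$ then $F\notin\mathscr K$; (K2) if $x\neq 0$ then $\{x\}\in\mathscr K$; (K3) if $F\preceq G$, $G\neq\emptyset$ and $F\in\mathscr K$, then $G\in\mathscr K$; (K4) if $F+G\in\mathscr K$ then $F\in\mathscr K$ or $G\in\mathscr K$. -}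

module Defs where

open import Level using (Level; _⊔_; Lift) renaming (suc to lsuc)
open import Data.Nat using (ℕ)
open import Data.Fin using (Fin)
open import Data.Product using (Σ; ∃; _×_)
open import Data.Sum using (_⊎_)
open import Relation.Nullary using (¬_)
open import Relation.Binary.PropositionalEquality using (_≡_)
open import Relation.Unary using (Pred)
open import Algebra.Lattice.Bundles using (BooleanAlgebra)

module _ {c ℓ : Level} (B : BooleanAlgebra c ℓ) where
  open BooleanAlgebra B renaming (⊥ to 𝟘; ⊤ to 𝟙; ¬_ to compl)

  _≤B_ : Carrier → Carrier → Set ℓ
  x ≤B y = (x ∨ y) ≈ y

  NonTrivial : Set ℓ
  NonTrivial = ¬ (𝟘 ≈ 𝟙)

  Finite : Set (c ⊔ ℓ)
  Finite = Σ ℕ λ n → Σ (Fin n → Carrier) λ e →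
             (∀ i j → e i ≈ e j → i ≡ j) × (∀ x → Σ (Fin n) λ i → e i ≈ x)

  IsAtom : Carrier → Set (c ⊔ ℓ)
  IsAtom a = ¬ (a ≈ 𝟘) × (∀ x → x ≤B a → (x ≈ 𝟘) ⊎ (x ≈ a))

  Subset : Set (lsuc (c ⊔ ℓ))
  Subset = Pred Carrier (c ⊔ ℓ)

  _⊆B_ : Subset → Subset → Set (c ⊔ ℓ)
  F ⊆B G = ∀ x → F x → G x

  AtomSubset : Subset → Set (c ⊔ ℓ)
  AtomSubset G = ∀ x → G x → IsAtom x

  NonEmpty : Subset → Set (c ⊔ ℓ)
  NonEmpty F = ∃ λ x → F x

  IsEmpty : Subset → Set (c ⊔ ℓ)
  IsEmpty F = ∀ x → ¬ F x

  _⊕_ : Subset → Subset → Subset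
  (F ⊕ G) x = ∃ λ f → ∃ λ g → F f × G g × (x ≈ (f ∨ g))

  ⟦_⟧ : Carrier → Subset
  ⟦ x ⟧ y = Lift c (y ≈ x)

  _⪯_ : Subset → Subset → Set (c ⊔ ℓ)
  F ⪯ G = ∀ g → G g → ∃ λ f → F f × (f ≤B g)

  record IsUltracontact {k : Level} (K : Subset → Set k) : Set (lsuc (c ⊔ ℓ) ⊔ k) where
    field
      K0 : ∀ F → IsEmpty F → ¬ K F
      K1 : ∀ F → F 𝟘 → ¬ K F
      K2 : ∀ x → ¬ (x ≈ 𝟘) → K ⟦ x ⟧
      K3 : ∀ F G → F ⪯ G → NonEmpty G → K F → K G
      K4 : ∀ F G → K (F ⊕ G) → K F ⊎ K G

-- By (K4), a member x of a family in K may be replaced by x ∧ z or by x ∧ ¬z (one of the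
-- two results stays in K), since every join of a member of the first family with one of
-- the second lies above a member of the original.  Running z over the whole finite algebra,
-- every member ends up below z or below ¬z for each z; being non-zero by (K1), it is an atom.
module Submission where

open import Defs
open import Level using (Level; _⊔_; lift)
open import Data.Nat using (ℕ; zero; suc)
open import Data.Fin using (Fin; zero; suc; _≟_)
open import Data.Product using (Σ; ∃; _×_; _,_)
open import Data.Sum as Sum using (_⊎_; inj₁; inj₂; [_,_]′)
open import Data.Vec.Functional using (Vector; updateAt)
open import Data.Vec.Functional.Properties using (updateAt-updates; updateAt-minimal)
open import Function.Bundles using (_⇔_; mk⇔)
open import Relation.Nullary using (¬_; yes; no)
open import Relation.Binary.PropositionalEquality as ≡ using (_≢_)
open import Algebra.Lattice.Bundles using (BooleanAlgebra)
import Algebra.Lattice.Properties.BooleanAlgebra as BooleanAlgebraProperties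
import Relation.Binary.Lattice as OrderLattice
import Relation.Binary.Reasoning.PartialOrder as ≤-Reasoning
import Relation.Binary.Reasoning.Setoid as SetoidReasoning

module BooleanOrder {c ℓ : Level} (B : BooleanAlgebra c ℓ) where
  open BooleanAlgebra B renaming (⊥ to 𝟘; ¬_ to compl)
  open BooleanAlgebraProperties B using (∨-∧-orderTheoreticLattice; ∧-identityʳ)
  open OrderLattice.Lattice ∨-∧-orderTheoreticLattice public
    using (_≤_; poset; ≤-respˡ-≈; ≤-respʳ-≈; x∧y≤x; x∧y≤y; x≤x∨y; y≤x∨y)
    renaming (refl to ≤-refl; reflexive to ≤-reflexive; trans to ≤-trans; antisym to ≤-antisym)

  ≤B⇒≤ : ∀ {x y} → _≤B_ B x y → x ≤ y
  ≤B⇒≤ {x} {y} x∨y≈y = begin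
    x             ≈⟨ ∧-absorbs-∨ x y ⟨
    x ∧ (x ∨ y)   ≈⟨ ∧-congˡ x∨y≈y ⟩
    x ∧ y         ∎
    where open SetoidReasoning setoid

  ≤⇒≤B : ∀ {x y} → x ≤ y → _≤B_ B x y
  ≤⇒≤B {x} {y} x≈x∧y = begin
    x ∨ y         ≈⟨ ∨-congʳ x≈x∧y ⟩
    (x ∧ y) ∨ y   ≈⟨ ∨-comm (x ∧ y) y ⟩
    y ∨ (x ∧ y)   ≈⟨ ∨-congˡ (∧-comm x y) ⟩
    y ∨ (y ∧ x)   ≈⟨ ∨-absorbs-∧ y x ⟩
    y             ∎
    where open SetoidReasoning setoid

  ≤-compl⇒≈𝟘 : ∀ {x} → x ≤ compl x → x ≈ 𝟘
  ≤-compl⇒≈𝟘 {x} x≈x∧¬x = trans x≈x∧¬x (∧-complementʳ x)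

  ∧-∨-∧-compl : ∀ x z → x ≈ (x ∧ z) ∨ (x ∧ compl z)
  ∧-∨-∧-compl x z = begin
    x                         ≈⟨ ∧-identityʳ x ⟨
    x ∧ ⊤                     ≈⟨ ∧-congˡ (∨-complementʳ z) ⟨
    x ∧ (z ∨ compl z)         ≈⟨ ∧-distribˡ-∨ x z (compl z) ⟩
    (x ∧ z) ∨ (x ∧ compl z)   ∎
    where open SetoidReasoning setoid

  Decided : Carrier → Carrier → Set ℓ
  Decided z x = x ≤ z ⊎ x ≤ compl z

  decided-≤ : ∀ {z x y} → y ≤ x → Decided z x → Decided z y
  decided-≤ y≤x = Sum.map (≤-trans y≤x) (≤-trans y≤x)

  DecidedBy : ∀ {m} → Vector Carrier m → Carrier → Set ℓ
  DecidedBy zs x = ∀ j → Decided (zs j) x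

  decidedBy-≤ : ∀ {m} {zs : Vector Carrier m} {x y} → y ≤ x → DecidedBy zs x → DecidedBy zs y
  decidedBy-≤ y≤x decided j = decided-≤ y≤x (decided j)

  decidedByAll⇒IsAtom : ∀ {m} {zs : Vector Carrier m} {a} → (∀ x → ∃ λ j → zs j ≈ x) →
                        ¬ a ≈ 𝟘 → DecidedBy zs a → IsAtom B a
  decidedByAll⇒IsAtom {a = a} onto a≉𝟘 decided = a≉𝟘 , λ x x≤a → below x (≤B⇒≤ x≤a)
    where
    below : ∀ x → x ≤ a → x ≈ 𝟘 ⊎ x ≈ a
    below x x≤a with onto x
    ... | j , zⱼ≈x with decided j
    ... | inj₁ a≤zⱼ = inj₂ (≤-antisym x≤a (≤-respʳ-≈ zⱼ≈x a≤zⱼ))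
    ... | inj₂ a≤¬zⱼ = inj₁ (≤-compl⇒≈𝟘 (≤-trans x≤a (≤-respʳ-≈ (¬-cong zⱼ≈x) a≤¬zⱼ)))

module Ultracontact {c ℓ k : Level} (B : BooleanAlgebra c ℓ) {K : Subset B → Set k}
                    (isUltracontact : IsUltracontact B K) where
  open BooleanAlgebra B renaming (⊥ to 𝟘; ¬_ to compl)
  open IsUltracontact isUltracontact
  open BooleanOrder B

  ⪯-intro : ∀ {F G : Subset B} → (∀ g → G g → ∃ λ f → F f × f ≤ g) → _⪯_ B F G
  ⪯-intro below g Gg with below g Gg
  ... | f , Ff , f≤g = f , Ff , ≤⇒≤B f≤g

  K-member-≉𝟘 : ∀ {H y} → K H → H y → ¬ y ≈ 𝟘
  K-member-≉𝟘 {H} {y} KH Hy y≈𝟘 = K1 ⟦𝟘⟧ (lift refl) (K3 H ⟦𝟘⟧ H⪯⟦𝟘⟧ (𝟘 , lift refl) KH)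
    where
    ⟦𝟘⟧ = ⟦_⟧ B 𝟘
    H⪯⟦𝟘⟧ : _⪯_ B H ⟦𝟘⟧
    H⪯⟦𝟘⟧ = ⪯-intro λ { g (lift g≈𝟘) → y , Hy , ≤-reflexive (trans y≈𝟘 (sym g≈𝟘)) }

  module Families {n : ℕ} (Selected : Fin n → Set (c ⊔ ℓ)) (someSelected : ∃ Selected) where

    ⟪_⟫ : Vector Carrier n → Subset B
    ⟪ w ⟫ y = ∃ λ i → Selected i × y ≈ w i

    _≼_ : Vector Carrier n → Vector Carrier n → Set ℓ
    w′ ≼ w = ∀ i → w′ i ≤ w i

    ≼-refl : ∀ {w} → w ≼ w
    ≼-refl i = ≤-refl

    ≼-trans : ∀ {w w′ w″} → w″ ≼ w′ → w′ ≼ w → w″ ≼ w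
    ≼-trans w″≼w′ w′≼w i = ≤-trans (w″≼w′ i) (w′≼w i)

    Refinement : Vector Carrier n → (Vector Carrier n → Set ℓ) → Set (c ⊔ ℓ ⊔ k)
    Refinement w P = ∃ λ w′ → K ⟪ w′ ⟫ × w′ ≼ w × P w′

    updateAt-≼ : ∀ w i {f : Carrier → Carrier} → (∀ x → f x ≤ x) → updateAt w i f ≼ w
    updateAt-≼ w i f≤ j with j ≟ i
    ... | yes ≡.refl = ≤-respˡ-≈ (sym (reflexive (updateAt-updates j w))) (f≤ (w j))
    ... | no j≢i     = ≤-reflexive (reflexive (updateAt-minimal j i w j≢i))

    split : ∀ {w} → K ⟪ w ⟫ → ∀ i z → Refinement w (λ w′ → Decided z (w′ i))
    split {w} Kw i z =
      [ refinedBy (_∧ z) (λ x → x∧y≤x x z) (inj₁ (x∧y≤y (w i) z))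
      , refinedBy (_∧ compl z) (λ x → x∧y≤x x (compl z)) (inj₂ (x∧y≤y (w i) (compl z)))
      ]′ (K4 ⟪ w₁ ⟫ ⟪ w₂ ⟫ Kw₁⊕w₂)
      where
      w₁ w₂ : Vector Carrier n
      w₁ = updateAt w i (_∧ z)
      w₂ = updateAt w i (_∧ compl z)

      updated : ∀ f → updateAt w i f i ≈ f (w i)
      updated f = reflexive (updateAt-updates i w)

      untouched : ∀ {a} f → a ≢ i → updateAt w i f a ≈ w a
      untouched {a} f a≢i = reflexive (updateAt-minimal a i w a≢i)

      refinedBy : ∀ f → (∀ x → f x ≤ x) → Decided z (f (w i)) →
                  K ⟪ updateAt w i f ⟫ → Refinement w (λ w′ → Decided z (w′ i))
      refinedBy f f≤ decided Kw′ =
        updateAt w i f , Kw′ , updateAt-≼ w i f≤ , decided-≤ (≤-reflexive (updated f)) decided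

      joinAbove : ∀ {a b u v} → Selected a → Selected b → u ≈ w₁ a → v ≈ w₂ b →
                  ∃ λ x → ⟪ w ⟫ x × x ≤ u ∨ v
      joinAbove {a} {b} {u} {v} sa sb u≈w₁a v≈w₂b with a ≟ i | b ≟ i
      ... | no a≢i | _ = w a , (a , sa , refl) , (begin
        w a     ≈⟨ trans u≈w₁a (untouched (_∧ z) a≢i) ⟨
        u       ≤⟨ x≤x∨y u v ⟩
        u ∨ v   ∎)
        where open ≤-Reasoning poset
      ... | yes _ | no b≢i = w b , (b , sb , refl) , (begin
        w b     ≈⟨ trans v≈w₂b (untouched (_∧ compl z) b≢i) ⟨
        v       ≤⟨ y≤x∨y u v ⟩
        u ∨ v   ∎)
        where open ≤-Reasoning poset
      ... | yes ≡.refl | yes ≡.refl = w i , (i , sa , refl) , ≤-reflexive (begin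
        w i                             ≈⟨ ∧-∨-∧-compl (w i) z ⟩
        (w i ∧ z) ∨ (w i ∧ compl z)     ≈⟨ ∨-cong (trans u≈w₁a (updated (_∧ z)))
                                                  (trans v≈w₂b (updated (_∧ compl z))) ⟨
        u ∨ v                           ∎)
        where open SetoidReasoning setoid

      Kw₁⊕w₂ : K (_⊕_ B ⟪ w₁ ⟫ ⟪ w₂ ⟫)
      Kw₁⊕w₂ = K3 _ _ (⪯-intro covered) nonempty Kw
        where
        covered : ∀ y → _⊕_ B ⟪ w₁ ⟫ ⟪ w₂ ⟫ y → ∃ λ x → ⟪ w ⟫ x × x ≤ y
        covered y (u , v , (a , sa , u≈w₁a) , (b , sb , v≈w₂b) , y≈u∨v)
          with joinAbove sa sb u≈w₁a v≈w₂b
        ... | x , x∈w , x≤u∨v = x , x∈w , ≤-respʳ-≈ (sym y≈u∨v) x≤u∨v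
        nonempty : NonEmpty B (_⊕_ B ⟪ w₁ ⟫ ⟪ w₂ ⟫)
        nonempty = let i₀ , s₀ = someSelected in
          w₁ i₀ ∨ w₂ i₀ , w₁ i₀ , w₂ i₀ , (i₀ , s₀ , refl) , (i₀ , s₀ , refl) , refl

    iterate : ∀ {m} {Q : Fin m → Vector Carrier n → Set ℓ} →
              (∀ j {w w′} → w′ ≼ w → Q j w → Q j w′) →
              (∀ j {w} → K ⟪ w ⟫ → Refinement w (Q j)) →
              ∀ {w} → K ⟪ w ⟫ → Refinement w (λ w′ → ∀ j → Q j w′)
    iterate {zero}  downward step {w} Kw = w , Kw , ≼-refl , λ ()
    iterate {suc m} downward step Kw with step zero Kw
    ... | w₁ , Kw₁ , w₁≼w , q₀ with iterate (λ j → downward (suc j)) (λ j → step (suc j)) Kw₁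
    ... | w₂ , Kw₂ , w₂≼w₁ , qs = w₂ , Kw₂ , ≼-trans w₂≼w₁ w₁≼w , λ where
      zero    → downward zero w₂≼w₁ q₀
      (suc j) → qs j

    decideAt : ∀ {w} → K ⟪ w ⟫ → ∀ i {m} (zs : Vector Carrier m) →
               Refinement w (λ w′ → DecidedBy zs (w′ i))
    decideAt Kw i zs = iterate (λ j w′≼w → decided-≤ (w′≼w i)) (λ j Kw′ → split Kw′ i (zs j)) Kw

    decideAll : ∀ {w} → K ⟪ w ⟫ → ∀ {m} (zs : Vector Carrier m) →
                Refinement w (λ w′ → ∀ i → DecidedBy zs (w′ i))
    decideAll Kw zs = iterate (λ i w′≼w → decidedBy-≤ (w′≼w i)) (λ i Kw′ → decideAt Kw′ i zs) Kw

  atomicRefinement : ∀ {n} (e : Vector Carrier n) → (∀ x → ∃ λ i → e i ≈ x) →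
                     ∀ {F} → NonEmpty B F → K F →
                     Σ (Subset B) λ G → AtomSubset B G × _⪯_ B G F × K G
  atomicRefinement {n} e onto {F} (f₀ , Ff₀) KF with onto f₀
  ... | i₀ , eᵢ₀≈f₀ = atomic (decideAll Ke e)
    where
    -- F need not respect ≈, so its members are tracked by their positions in e.
    Listed : Fin n → Set (c ⊔ ℓ)
    Listed i = ∃ λ f → F f × f ≈ e i

    listedᵢ₀ : Listed i₀
    listedᵢ₀ = f₀ , Ff₀ , sym eᵢ₀≈f₀

    open Families Listed (i₀ , listedᵢ₀)

    Ke : K ⟪ e ⟫
    Ke = K3 F ⟪ e ⟫ (⪯-intro F⪯e) (e i₀ , i₀ , listedᵢ₀ , refl) KF
      where
      F⪯e : ∀ y → ⟪ e ⟫ y → ∃ λ f → F f × f ≤ y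
      F⪯e y (i , (f , Ff , f≈eᵢ) , y≈eᵢ) = f , Ff , ≤-reflexive (trans f≈eᵢ (sym y≈eᵢ))

    atomic : Refinement e (λ w → ∀ i → DecidedBy e (w i)) →
             Σ (Subset B) λ G → AtomSubset B G × _⪯_ B G F × K G
    atomic (w , Kw , w≼e , decided) = ⟪ w ⟫ , atoms , ⪯-intro w⪯F , Kw
      where
      atoms : AtomSubset B ⟪ w ⟫
      atoms y y∈w@(i , _ , y≈wᵢ) =
        decidedByAll⇒IsAtom onto (K-member-≉𝟘 Kw y∈w) (decidedBy-≤ (≤-reflexive y≈wᵢ) (decided i))

      w⪯F : ∀ f → F f → ∃ λ y → ⟪ w ⟫ y × y ≤ f
      w⪯F f Ff with onto f
      ... | i , eᵢ≈f = w i , (i , (f , Ff , sym eᵢ≈f) , refl) , ≤-respʳ-≈ eᵢ≈f (w≼e i)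

lemma7p1 : {c ℓ k : Level} (B : BooleanAlgebra c ℓ) → NonTrivial B → Finite B →
    (K : Subset B → Set k) → IsUltracontact B K →
    (F : Subset B) → NonEmpty B F →
    K F ⇔ Σ (Subset B) (λ G → AtomSubset B G × _⪯_ B G F × K G)
lemma7p1 B _ (_ , e , _ , onto) K isUltracontact F nonempty =
  mk⇔ (atomicRefinement e onto nonempty)
      (λ (G , _ , G⪯F , KG) → K3 G F G⪯F nonempty KG)
  where
  open Ultracontact B isUltracontact
  open IsUltracontact isUltracontact
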